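{- Let $m\ge n\ge2$ be integers. The number of $n\times m$ Ferrers diagrams $\mathcal{F}$ for which the pair $(\mathcal{F},2)$ is MDS-constructible is $$\frac{m-n+1}{m}\binom{m+n-2}{n-1}.$$ In particular, the number of $n\times n$ Ferrers diagrams $\mathcal{F}$ for which $(\mathcal{F},2)$ is MDS-constructible is the $(n-1)$-th Catalan number $\frac{1}{n}\binom{2n-2}{n-1}$.
   Context: $[i]=\{1,\dots,i\}$. An $n\times m$ Ferrers diagram is a subset $\mathcal{F}\subseteq[n]\times[m]$ such that $(1,1),(n,m)\in\mathcal{F}$; if $(i,j)\in\mathcal{F}$ and $j<m$ then $(i,j+1)\in\mathcal{F}$; and if $(i,j)\in\mathcal{F}$ and $i>1$ then $(i-1,j)\in\mathcal{F}$. Let $c_j=|\{i:(i,j)\in\mathcal{F}\}|$. For $1\le d\le\min\{n,m\}$ and $0\le j\le d-1$ set $\kappa_j(\mathcal{F},d)=\sum_{t=1}^{m-d+1+j}\max\{c_t-j,0\}$ and $\kappa(\mathcal{F},d)=\min_j\kappa_j(\mathcal{F},d)$. For $1\le i\le m+n-1$, $D_i=\{(a,b)\in[n]\times[m]: b-a=m-i\}$. The pair $(\mathcal{F},d)$ is MDS-constructible if $\kappa(\mathcal{F},d)=\sum_{i=1}^{m+n-1}\max\{0,|D_i\cap\mathcal{F}|-d+1\}$. -}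

module Defs where

open import Data.Bool using (Bool; true; false; if_then_else_; _∧_)
open import Data.Nat using (ℕ; zero; suc; _+_; _*_; _∸_; _⊓_; _<_; _≡ᵇ_)
open import Data.List using (List; []; _∷_; map; upTo)
open import Data.Nat.ListAction using (sum)
open import Data.Vec using (Vec; []; _∷_; replicate)
open import Data.Product using (_×_)
open import Relation.Binary.PropositionalEquality using (_≡_)

range : ℕ → List ℕ
range k = map suc (upTo k)

sumTo : ℕ → (ℕ → ℕ) → ℕ
sumTo k f = sum (map f (range k))

ind : Bool → ℕ
ind true  = 1
ind false = 0

-- An n×m 0/1 array; a subset of [n]×[m] is represented by its indicator
-- array: entry (i , j) with 1 ≤ i ≤ n (row), 1 ≤ j ≤ m (column).
Grid : ℕ → ℕ → Set
Grid n m = Vec (Vec Bool m) n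

-- 1-based lookup with default for out-of-range indices
at : {A : Set} {k : ℕ} → A → Vec A k → ℕ → A
at d []       _             = d
at d (x ∷ xs) zero          = d
at d (x ∷ xs) (suc zero)    = x
at d (x ∷ xs) (suc (suc i)) = at d xs (suc i)

-- inF F i j = true  iff  (i , j) ∈ F   (false outside [n]×[m])
inF : {n m : ℕ} → Grid n m → ℕ → ℕ → Bool
inF {n} {m} F i j = at false (at (replicate m false) F i) j

IsFerrers : {n m : ℕ} → Grid n m → Set
IsFerrers {n} {m} F =
  (inF F 1 1 ≡ true) ×
  (inF F n m ≡ true) ×
  (∀ i j → inF F i j ≡ true → j < m → inF F i (suc j) ≡ true) ×
  (∀ i j → inF F i j ≡ true → 1 < i → inF F (i ∸ 1) j ≡ true)

colCount : {n m : ℕ} → Grid n m → ℕ → ℕ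
colCount {n} F j = sumTo n (λ i → ind (inF F i j))

kappaJ : {n m : ℕ} → Grid n m → ℕ → ℕ → ℕ
kappaJ {n} {m} F d j = sumTo (m ∸ d + 1 + j) (λ t → colCount F t ∸ j)

minUpTo : ℕ → (ℕ → ℕ) → ℕ
minUpTo zero    f = f 0
minUpTo (suc k) f = minUpTo k f ⊓ f (suc k)

-- κ(F,d) = min_{0 ≤ j ≤ d-1} κ_j(F,d)   (used for d ≥ 1)
kappa : {n m : ℕ} → Grid n m → ℕ → ℕ
kappa F d = minUpTo (d ∸ 1) (kappaJ F d)

-- |D_i ∩ F| where D_i = {(a,b) ∈ [n]×[m] : b - a = m - i}
-- (b - a = m - i over ℤ is equivalently b + i = a + m over ℕ)
diagCount : {n m : ℕ} → Grid n m → ℕ → ℕ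
diagCount {n} {m} F i =
  sumTo n (λ a → sumTo m (λ b → ind ((b + i ≡ᵇ a + m) ∧ inF F a b)))

-- Σ_{i=1}^{m+n-1} max{0, |D_i ∩ F| - d + 1}   (for d ≥ 1, max{0,x-d+1} = x ∸ (d-1))
diagBound : {n m : ℕ} → Grid n m → ℕ → ℕ
diagBound {n} {m} F d = sumTo (m + n ∸ 1) (λ i → diagCount F i ∸ (d ∸ 1))

MDSConstructible : {n m : ℕ} → Grid n m → ℕ → Set
MDSConstructible F d = kappa F d ≡ diagBound F d

-- For a Ferrers diagram F with n ≤ m the first row and the last column are full, so
-- κ₁(F, 2) = |F| − m ≤ |F| − n = κ₀(F, 2) and κ(F, 2) = |F| − m.  Every cell lies on exactly
-- one diagonal and the diagonals D₁, …, D_m all meet the first row, so the diagonal bound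
-- is |F| − m minus the number of nonempty diagonals below the main one.  Hence (F, 2) is
-- MDS-constructible iff F lies on or above the main diagonal.  Such a diagram is determined
-- by the columns s_a where its rows start: 1 = s₁ ≤ … ≤ s_n ≤ m with a ≤ s_a.  Splitting on
-- whether s_n = m gives Pascal's recursion, solved by the reflection principle:
-- C(m + n − 2, n − 1) − C(m + n − 2, n − 2) = (m − n + 1)/m · C(m + n − 2, n − 1).

module Submission where

open import Defs

open import Algebra.Properties.CommutativeSemigroup using (interchange)
open import Data.Bool using (Bool; true; false; if_then_else_; _∧_)
open import Data.Bool.Properties using (∧-zeroʳ; ∧-identityʳ; T-≡; ¬-not)
open import Data.List using (List; []; _∷_; length; map; _++_; upTo)
open import Data.List.Properties using (length-++; length-map; map-++; upTo-∷ʳ; ++-identityʳ)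
open import Data.List.Membership.Propositional using (_∈_)
open import Data.List.Membership.Propositional.Properties using (∈-map⁺; ∈-map⁻; ∈-++⁺ˡ; ∈-++⁺ʳ)
open import Data.List.Relation.Binary.Disjoint.Propositional using (Disjoint)
open import Data.List.Relation.Unary.All using (All; []; _∷_)
import Data.List.Relation.Unary.All as All
import Data.List.Relation.Unary.All.Properties as All
open import Data.List.Relation.Unary.AllPairs using ([]; _∷_)
open import Data.List.Relation.Unary.Any using (here; there)
open import Data.List.Relation.Unary.Unique.Propositional using (Unique)
import Data.List.Relation.Unary.Unique.Propositional.Properties as Unique
open import Data.Nat using (ℕ; zero; suc; _+_; _*_; _∸_; _≤_; _<_; _≤ᵇ_; _≡ᵇ_; _⊓_; z≤n; s≤s)
open import Data.Nat.Combinatorics using (_C_; nCk+nC[k+1]≡[n+1]C[k+1]; nCk≡nC[n∸k]; nC1≡n; k>n⇒nCk≡0)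
open import Data.Nat.ListAction using (sum)
open import Data.Nat.ListAction.Properties using (sum-++)
open import Data.Nat.Properties
open import Data.Nat.Solver using (module +-*-Solver)
open import Data.Product using (Σ; _×_; _,_; proj₁; proj₂)
open import Data.Sum using (_⊎_; inj₁; inj₂)
open import Data.Vec using (Vec; []; _∷_; _∷ʳ_; replicate; initLast)
import Data.Vec as Vec
open import Data.Vec.Properties using (∷ʳ-injective)
open import Function.Base using (_∘_)
open import Function.Bundles using (_⇔_; mk⇔; Equivalence)
open import Relation.Nullary using (yes; no; contradiction)
open import Relation.Binary.PropositionalEquality
  using (_≡_; _≢_; refl; sym; trans; cong; cong₂; subst; subst₂; module ≡-Reasoning)

open +-*-Solver using (solve; _:=_; _:+_; _:*_; con)
open ≡-Reasoning

≤ᵇ≡true⇒≤ : ∀ {a b} → (a ≤ᵇ b) ≡ true → a ≤ b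
≤ᵇ≡true⇒≤ {a} {b} e = ≤ᵇ⇒≤ a b (Equivalence.from T-≡ e)

≤⇒≤ᵇ≡true : ∀ {a b} → a ≤ b → (a ≤ᵇ b) ≡ true
≤⇒≤ᵇ≡true = Equivalence.to T-≡ ∘ ≤⇒≤ᵇ

>⇒≤ᵇ≡false : ∀ {a b} → b < a → (a ≤ᵇ b) ≡ false
>⇒≤ᵇ≡false b<a = ¬-not (λ e → <⇒≱ b<a (≤ᵇ≡true⇒≤ e))

suc≤ᵇsuc : ∀ a b → (suc a ≤ᵇ suc b) ≡ (a ≤ᵇ b)
suc≤ᵇsuc zero    b = refl
suc≤ᵇsuc (suc a) b = refl

≡ᵇ-refl : ∀ a → (a ≡ᵇ a) ≡ true
≡ᵇ-refl a = Equivalence.to T-≡ (≡⇒≡ᵇ a a refl)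

≢⇒≡ᵇ≡false : ∀ {a b} → a ≢ b → (a ≡ᵇ b) ≡ false
≢⇒≡ᵇ≡false {a} {b} a≢b = ¬-not (λ e → a≢b (≡ᵇ⇒≡ a b (Equivalence.from T-≡ e)))

if-then-else-[] : ∀ {A : Set} (P : List A → Set) b {xs} → P [] → (b ≡ true → P xs) → P (if b then xs else [])
if-then-else-[] P true  _   h = h refl
if-then-else-[] P false p[] _ = p[]

Unique-map⁺ : ∀ {A B : Set} (f : A → B) {xs : List A} →
              (∀ {x y} → x ∈ xs → y ∈ xs → f x ≡ f y → x ≡ y) → Unique xs → Unique (map f xs)
Unique-map⁺ f             _   []           = []
Unique-map⁺ f {x ∷ xs} inj (x∉xs ∷ uniq) =
  All.map⁺ (All.tabulate (λ y∈ fx≡fy → All.lookup x∉xs y∈ (inj (here refl) (there y∈) fx≡fy))) ∷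
  Unique-map⁺ f (λ x∈ y∈ → inj (there x∈) (there y∈)) uniq

at-∷ʳ : ∀ {A : Set} {n} (d x : A) (v : Vec A n) a → a ≤ n → at d (v ∷ʳ x) a ≡ at d v a
at-∷ʳ d x []       zero          _       = refl
at-∷ʳ d x (y ∷ v)  zero          _       = refl
at-∷ʳ d x (y ∷ v)  (suc zero)    _       = refl
at-∷ʳ d x (y ∷ v)  (suc (suc a)) (s≤s p) = at-∷ʳ d x v (suc a) p

at-∷ʳ-last : ∀ {A : Set} {n} (d x : A) (v : Vec A n) → at d (v ∷ʳ x) (suc n) ≡ x
at-∷ʳ-last d x []      = refl
at-∷ʳ-last d x (y ∷ v) = at-∷ʳ-last d x v

at-map : ∀ {A B : Set} {n} (f : A → B) {d : B} {d′ : A} (v : Vec A n) a →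
         1 ≤ a → a ≤ n → at d (Vec.map f v) a ≡ f (at d′ v a)
at-map f (x ∷ v) (suc zero)    _ _       = refl
at-map f (x ∷ v) (suc (suc a)) _ (s≤s p) = at-map f v (suc a) (s≤s z≤n) p

at-replicate : ∀ {A : Set} m (d : A) a → at d (replicate m d) a ≡ d
at-replicate zero    d a             = refl
at-replicate (suc m) d zero          = refl
at-replicate (suc m) d (suc zero)    = refl
at-replicate (suc m) d (suc (suc a)) = at-replicate m d (suc a)

at-inRange⊎default : ∀ {A : Set} {n} (d : A) (v : Vec A n) a → (1 ≤ a × a ≤ n) ⊎ at d v a ≡ d
at-inRange⊎default d []      a             = inj₂ refl
at-inRange⊎default d (x ∷ v) zero          = inj₂ refl
at-inRange⊎default d (x ∷ v) (suc zero)    = inj₁ (s≤s z≤n , s≤s z≤n)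
at-inRange⊎default d (x ∷ v) (suc (suc a)) with at-inRange⊎default d v (suc a)
... | inj₁ (_ , a≤n) = inj₁ (s≤s z≤n , s≤s a≤n)
... | inj₂ e         = inj₂ e

at-ext : ∀ {A : Set} {n} (d : A) (u v : Vec A n) →
         (∀ a → 1 ≤ a → a ≤ n → at d u a ≡ at d v a) → u ≡ v
at-ext d []      []      _ = refl
at-ext d (x ∷ u) (y ∷ v) h = cong₂ _∷_ (h 1 (s≤s z≤n) (s≤s z≤n))
  (at-ext d u v (λ { (suc a) _ a≤n → h (suc (suc a)) (s≤s z≤n) (s≤s a≤n) }))

∑ : ℕ → (ℕ → ℕ) → ℕ
∑ zero    f = 0
∑ (suc k) f = ∑ k f + f (suc k)

sumTo≡∑ : ∀ k f → sumTo k f ≡ ∑ k f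
sumTo≡∑ zero    f = refl
sumTo≡∑ (suc k) f = begin
  sum (map f (map suc (upTo (suc k))))        ≡⟨ cong (sum ∘ map f ∘ map suc) (upTo-∷ʳ k) ⟨
  sum (map f (map suc (upTo k ++ k ∷ [])))    ≡⟨ cong (sum ∘ map f) (map-++ suc (upTo k) (k ∷ [])) ⟩
  sum (map f (range k ++ suc k ∷ []))         ≡⟨ cong sum (map-++ f (range k) (suc k ∷ [])) ⟩
  sum (map f (range k) ++ f (suc k) ∷ [])     ≡⟨ sum-++ (map f (range k)) (f (suc k) ∷ []) ⟩
  sumTo k f + (f (suc k) + 0)                 ≡⟨ cong₂ _+_ (sumTo≡∑ k f) (+-identityʳ (f (suc k))) ⟩
  ∑ (suc k) f                                 ∎

∑-cong : ∀ k {f g} → (∀ i → 1 ≤ i → i ≤ k → f i ≡ g i) → ∑ k f ≡ ∑ k g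
∑-cong zero    h = refl
∑-cong (suc k) h = cong₂ _+_ (∑-cong k (λ i p q → h i p (m≤n⇒m≤1+n q))) (h (suc k) (s≤s z≤n) ≤-refl)

∑-zero : ∀ k {f} → (∀ i → 1 ≤ i → i ≤ k → f i ≡ 0) → ∑ k f ≡ 0
∑-zero zero    h = refl
∑-zero (suc k) h = cong₂ _+_ (∑-zero k (λ i p q → h i p (m≤n⇒m≤1+n q))) (h (suc k) (s≤s z≤n) ≤-refl)

∑-const-1 : ∀ k → ∑ k (λ _ → 1) ≡ k
∑-const-1 zero    = refl
∑-const-1 (suc k) = trans (cong (_+ 1) (∑-const-1 k)) (+-comm k 1)

∑-distrib-+ : ∀ k f g → ∑ k (λ i → f i + g i) ≡ ∑ k f + ∑ k g
∑-distrib-+ zero    f g = refl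
∑-distrib-+ (suc k) f g =
  trans (cong (_+ (f (suc k) + g (suc k))) (∑-distrib-+ k f g))
        (interchange +-commutativeSemigroup (∑ k f) (∑ k g) (f (suc k)) (g (suc k)))

∑-comm : ∀ a b (f : ℕ → ℕ → ℕ) → ∑ a (λ i → ∑ b (f i)) ≡ ∑ b (λ j → ∑ a (λ i → f i j))
∑-comm zero    b f = sym (∑-zero b (λ _ _ _ → refl))
∑-comm (suc a) b f =
  trans (cong (_+ ∑ b (f (suc a))) (∑-comm a b f))
        (sym (∑-distrib-+ b (λ j → ∑ a (λ i → f i j)) (f (suc a))))

∑-+ : ∀ a b f → ∑ (a + b) f ≡ ∑ a f + ∑ b (λ i → f (a + i))
∑-+ a zero    f = trans (cong (λ k → ∑ k f) (+-identityʳ a)) (sym (+-identityʳ (∑ a f)))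
∑-+ a (suc b) f = begin
  ∑ (a + suc b) f                                   ≡⟨ cong (λ k → ∑ k f) (+-suc a b) ⟩
  ∑ (a + b) f + f (suc (a + b))                     ≡⟨ cong₂ _+_ (∑-+ a b f) (cong f (sym (+-suc a b))) ⟩
  ∑ a f + ∑ b (λ i → f (a + i)) + f (a + suc b)     ≡⟨ +-assoc (∑ a f) _ _ ⟩
  ∑ a f + ∑ (suc b) (λ i → f (a + i))               ∎

≤-∑ : ∀ k f {i} → 1 ≤ i → i ≤ k → f i ≤ ∑ k f
≤-∑ zero    f (s≤s _) ()
≤-∑ (suc k) f {i} 1≤i i≤1+k with m≤n⇒m<n∨m≡n i≤1+k
... | inj₁ (s≤s i≤k) = ≤-trans (≤-∑ k f 1≤i i≤k) (m≤m+n _ _)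
... | inj₂ refl      = m≤n+m _ _

∑-ind-≡ᵇ : ∀ K b c → b < c → c ≤ b + K → ∑ K (λ i → ind (b + i ≡ᵇ c)) ≡ 1
∑-ind-≡ᵇ zero    b c b<c c≤b = contradiction (subst (c ≤_) (+-identityʳ b) c≤b) (<⇒≱ b<c)
∑-ind-≡ᵇ (suc K) b c b<c c≤b+1+K with m≤n⇒m<n∨m≡n c≤b+1+K
... | inj₁ c<b+1+K = cong₂ _+_
  (∑-ind-≡ᵇ K b c b<c (≤-pred (subst (c <_) (+-suc b K) c<b+1+K)))
  (cong ind (≢⇒≡ᵇ≡false (>⇒≢ c<b+1+K)))
... | inj₂ refl = cong₂ _+_
  (∑-zero K (λ i _ i≤K → cong ind (≢⇒≡ᵇ≡false (<⇒≢ (+-monoʳ-< b (s≤s i≤K))))))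
  (cong ind (≡ᵇ-refl (b + suc K)))

InRange : ℕ → ℕ → ℕ → ℕ → Set
InRange n m a b = (1 ≤ a × a ≤ n) × (1 ≤ b × b ≤ m)

inF-inRange : ∀ {n m} (F : Grid n m) {a b} → inF F a b ≡ true → InRange n m a b
inF-inRange {n} {m} F {a} {b} a,b∈F with at-inRange⊎default (replicate m false) F a
... | inj₂ default rewrite default | at-replicate m false b = contradiction a,b∈F λ ()
... | inj₁ a∈[1,n] with at-inRange⊎default false (at (replicate m false) F a) b
...   | inj₁ b∈[1,m] = a∈[1,n] , b∈[1,m]
...   | inj₂ default = contradiction (trans (sym a,b∈F) default) λ ()

grid-ext : ∀ {n m} (F G : Grid n m) → (∀ a b → InRange n m a b → inF F a b ≡ inF G a b) → F ≡ G
grid-ext {n} {m} F G h = at-ext (replicate m false) F G λ a p q → at-ext false _ _ λ b r s → h a b ((p , q) , (r , s))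

UpperTriangular : ∀ {n m} → Grid n m → Set
UpperTriangular F = ∀ a b → inF F a b ≡ true → a ≤ b

cellsFrom : (m j s : ℕ) → Vec Bool m
cellsFrom zero    j s = []
cellsFrom (suc m) j s = (s ≤ᵇ j) ∷ cellsFrom m (suc j) s

at-cellsFrom : ∀ m j s k → k < m → at false (cellsFrom m j s) (suc k) ≡ (s ≤ᵇ j + k)
at-cellsFrom (suc m) j s zero    _       = cong (s ≤ᵇ_) (sym (+-identityʳ j))
at-cellsFrom (suc m) j s (suc k) (s≤s p) = trans (at-cellsFrom m (suc j) s k p) (cong (s ≤ᵇ_) (sym (+-suc j k)))

diagramOf : ∀ {n m} → Vec ℕ n → Grid n m
diagramOf {m = m} s = Vec.map (cellsFrom m 1) s

inF-diagramOf : ∀ {n m} (s : Vec ℕ n) {a b} → InRange n m a b → inF (diagramOf {n} {m} s) a b ≡ (at 0 s a ≤ᵇ b)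
inF-diagramOf {n} {m} s {a} {suc b} ((p , q) , (_ , b<m)) =
  trans (cong (λ row → at false row (suc b)) (at-map (cellsFrom m 1) s a p q)) (at-cellsFrom m 1 (at 0 s a) b b<m)

∈diagramOf⇒ : ∀ {n m} (s : Vec ℕ n) {a b} → inF (diagramOf {n} {m} s) a b ≡ true →
              InRange n m a b × at 0 s a ≤ b
∈diagramOf⇒ s a,b∈G = ab , ≤ᵇ≡true⇒≤ (trans (sym (inF-diagramOf s ab)) a,b∈G)
  where ab = inF-inRange (diagramOf s) a,b∈G

∈diagramOf⇐ : ∀ {n m} (s : Vec ℕ n) {a b} → InRange n m a b → at 0 s a ≤ b →
              inF (diagramOf {n} {m} s) a b ≡ true
∈diagramOf⇐ s ab sₐ≤b = trans (inF-diagramOf s ab) (≤⇒≤ᵇ≡true sₐ≤b)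

-- The column of the first cell of a row, or m + 1 if the row is empty.
firstTrue : ∀ {m} → Vec Bool m → ℕ
firstTrue []          = 1
firstTrue (true ∷ r)  = 1
firstTrue (false ∷ r) = suc (firstTrue r)

1≤firstTrue : ∀ {m} (r : Vec Bool m) → 1 ≤ firstTrue r
1≤firstTrue []          = s≤s z≤n
1≤firstTrue (true ∷ r)  = s≤s z≤n
1≤firstTrue (false ∷ r) = s≤s z≤n

RightClosed : ∀ {m} → Vec Bool m → Set
RightClosed {m} r = ∀ j → at false r j ≡ true → j < m → at false r (suc j) ≡ true

rightClosed-full : ∀ {m} (r : Vec Bool m) → RightClosed r → at false r 1 ≡ true →
                   ∀ b → 1 ≤ b → b ≤ m → at false r b ≡ true
rightClosed-full r closed r₁ (suc zero)    _ _   = r₁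
rightClosed-full r closed r₁ (suc (suc b)) _ b<m =
  closed (suc b) (rightClosed-full r closed r₁ (suc b) (s≤s z≤n) (<⇒≤ b<m)) b<m

rightClosed-tail : ∀ {m} x (r : Vec Bool m) → RightClosed (x ∷ r) → RightClosed r
rightClosed-tail x []      closed zero    () _
rightClosed-tail x (_ ∷ _) closed zero    () _
rightClosed-tail x r       closed (suc j) r-j j<m = closed (suc (suc j)) r-j (s≤s j<m)

rightClosed-at : ∀ {m} (r : Vec Bool m) → RightClosed r →
                 ∀ b → 1 ≤ b → b ≤ m → at false r b ≡ (firstTrue r ≤ᵇ b)
rightClosed-at (true ∷ r)  closed (suc b)       p q       = rightClosed-full (true ∷ r) closed refl (suc b) p q
rightClosed-at (false ∷ r) closed (suc zero)    _ _       = sym (>⇒≤ᵇ≡false (s≤s (1≤firstTrue r)))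
rightClosed-at (false ∷ r) closed (suc (suc b)) _ (s≤s q) =
  trans (rightClosed-at r (rightClosed-tail false r closed) (suc b) (s≤s z≤n) q) (sym (suc≤ᵇsuc (firstTrue r) (suc b)))

-- Cell counts along columns and diagonals

size : ∀ {n m} → Grid n m → ℕ
size {n} {m} F = ∑ n (λ a → ∑ m (λ b → ind (inF F a b)))

∑-colCount≡size : ∀ {n m} (F : Grid n m) → ∑ m (colCount F) ≡ size F
∑-colCount≡size {n} {m} F = trans (∑-cong m (λ t _ _ → sumTo≡∑ n _)) (sym (∑-comm n m _))

onDiagonal : ∀ {n m} → Grid n m → ℕ → ℕ → ℕ → ℕ
onDiagonal {m = m} F i a b = ind ((b + i ≡ᵇ a + m) ∧ inF F a b)

diagCount≡∑ : ∀ {n m} (F : Grid n m) i → diagCount F i ≡ ∑ n (λ a → ∑ m (onDiagonal F i a))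
diagCount≡∑ {n} {m} F i = trans (sumTo≡∑ n _) (∑-cong n (λ a _ _ → sumTo≡∑ m _))

-- Cell (a, b) lies on the diagonal D_i with i = a + m − b, which ranges over [1, m + n − 1].
∑-onDiagonal : ∀ {n m} (F : Grid n m) {a b} → InRange n m a b →
               ∑ (m + n ∸ 1) (λ i → onDiagonal F i a b) ≡ ind (inF F a b)
∑-onDiagonal {n} {m} F {a} {b} ((1≤a , a≤n) , (1≤b , b≤m)) with inF F a b
... | false = ∑-zero (m + n ∸ 1) (λ i _ _ → cong ind (∧-zeroʳ _))
... | true  = trans (∑-cong (m + n ∸ 1) (λ i _ _ → cong ind (∧-identityʳ _)))
                    (∑-ind-≡ᵇ (m + n ∸ 1) b (a + m) b<a+m a+m≤b+K)
  where
  b<a+m : b < a + m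
  b<a+m = ≤-trans (s≤s b≤m) (+-monoˡ-≤ m 1≤a)
  a+m≤b+K : a + m ≤ b + (m + n ∸ 1)
  a+m≤b+K = ≤-trans (+-monoˡ-≤ m a≤n) (≤-trans (≤-reflexive (trans (+-comm n m) (sym (m+[n∸m]≡n 1≤m+n))))
                                                 (+-monoˡ-≤ (m + n ∸ 1) 1≤b))
    where 1≤m+n = ≤-trans (≤-trans 1≤a a≤n) (m≤n+m n m)

∑-diagCount≡size : ∀ {n m} (F : Grid n m) → ∑ (m + n ∸ 1) (diagCount F) ≡ size F
∑-diagCount≡size {n} {m} F = begin
  ∑ K (diagCount F)                                    ≡⟨ ∑-cong K (λ i _ _ → diagCount≡∑ F i) ⟩
  ∑ K (λ i → ∑ n (λ a → ∑ m (onDiagonal F i a)))       ≡⟨ ∑-comm K n _ ⟩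
  ∑ n (λ a → ∑ K (λ i → ∑ m (onDiagonal F i a)))       ≡⟨ ∑-cong n (λ a _ _ → ∑-comm K m _) ⟩
  ∑ n (λ a → ∑ m (λ b → ∑ K (λ i → onDiagonal F i a b)))
    ≡⟨ ∑-cong n (λ a p q → ∑-cong m (λ b r t → ∑-onDiagonal F ((p , q) , (r , t)))) ⟩
  size F                                               ∎
  where K = m + n ∸ 1

1≤diagCount : ∀ {n m} (F : Grid n m) {i a b} → inF F a b ≡ true → b + i ≡ a + m → 1 ≤ diagCount F i
1≤diagCount {n} {m} F {i} {a} {b} a,b∈F on-Dᵢ = subst (1 ≤_) (sym (diagCount≡∑ F i))
  (≤-trans (≤-trans (≤-reflexive (sym on-Dᵢ≡1)) (≤-∑ m (onDiagonal F i a) (proj₁ b∈[1,m]) (proj₂ b∈[1,m])))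
           (≤-∑ n (λ a → ∑ m (onDiagonal F i a)) (proj₁ a∈[1,n]) (proj₂ a∈[1,n])))
  where
  a∈[1,n] = proj₁ (inF-inRange F a,b∈F)
  b∈[1,m] = proj₂ (inF-inRange F a,b∈F)
  on-Dᵢ≡1 : onDiagonal F i a b ≡ 1
  on-Dᵢ≡1 rewrite on-Dᵢ | ≡ᵇ-refl (a + m) | a,b∈F = refl

-- The number of nonempty diagonals D_{m+1}, …, D_{m+n−1} strictly below the main diagonal.
lowerDiagonals : ∀ {n m} → Grid n m → ℕ
lowerDiagonals {n} {m} F = ∑ (n ∸ 1) (λ i → 1 ⊓ diagCount F (m + i))

lowerDiagonals≡0⇒upperTriangular : ∀ {n m} (F : Grid n m) → lowerDiagonals F ≡ 0 → UpperTriangular F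
lowerDiagonals≡0⇒upperTriangular {n} {m} F none a b a,b∈F with a ≤? b
... | yes a≤b = a≤b
... | no  a≰b =
  contradiction (subst (1 ≤_) none (≤-trans (≤-reflexive (sym nonempty)) (≤-∑ (n ∸ 1) _ 1≤i i≤n-1))) λ ()
  where
  b<a = ≰⇒> a≰b
  i = a ∸ b
  1≤i : 1 ≤ i
  1≤i = m<n⇒0<n∸m b<a
  i≤n-1 : i ≤ n ∸ 1
  i≤n-1 = ∸-mono (proj₂ (proj₁ (inF-inRange F a,b∈F))) (proj₁ (proj₂ (inF-inRange F a,b∈F)))
  on-Dₘ₊ᵢ : b + (m + i) ≡ a + m
  on-Dₘ₊ᵢ = begin
    b + (m + (a ∸ b)) ≡⟨ cong (b +_) (+-comm m (a ∸ b)) ⟩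
    b + (a ∸ b + m)   ≡⟨ +-assoc b (a ∸ b) m ⟨
    b + (a ∸ b) + m   ≡⟨ cong (_+ m) (m+[n∸m]≡n (<⇒≤ b<a)) ⟩
    a + m             ∎
  nonempty : 1 ⊓ diagCount F (m + i) ≡ 1
  nonempty = m≤n⇒m⊓n≡m (1≤diagCount F a,b∈F on-Dₘ₊ᵢ)

upperTriangular⇒lowerDiagonals≡0 : ∀ {n m} (F : Grid n m) → UpperTriangular F → lowerDiagonals F ≡ 0
upperTriangular⇒lowerDiagonals≡0 {n} {m} F upper = ∑-zero (n ∸ 1) λ i 1≤i _ →
  cong (1 ⊓_) (trans (diagCount≡∑ F (m + i)) (∑-zero n (λ a _ _ → ∑-zero m (λ b _ _ → off-diagonal i 1≤i a b))))
  where
  off-diagonal : ∀ i → 1 ≤ i → ∀ a b → onDiagonal F (m + i) a b ≡ 0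
  off-diagonal i 1≤i a b with inF F a b in a,b∈F
  ... | false = cong ind (∧-zeroʳ _)
  ... | true  = cong ind (trans (∧-identityʳ _) (≢⇒≡ᵇ≡false (>⇒≢ a+m<b+m+i)))
    where
    a+m<b+m+i : a + m < b + (m + i)
    a+m<b+m+i = +-mono-≤-< (upper a b a,b∈F) (subst (_≤ m + i) (+-comm m 1) (+-monoʳ-≤ m 1≤i))

-- Ferrers diagrams and κ(F, 2)

module FerrersDiagram {n m : ℕ} (F : Grid n m) (ferrers : IsFerrers F) where
  private
    row : ℕ → Vec Bool m
    row a = at (replicate m false) F a

    bottomRight : inF F n m ≡ true
    bottomRight = proj₁ (proj₂ ferrers)

    rightClosed : ∀ a → RightClosed (row a)
    rightClosed = proj₁ (proj₂ (proj₂ ferrers))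

  topLeft : inF F 1 1 ≡ true
  topLeft = proj₁ ferrers

  upClosed : ∀ a b → inF F a b ≡ true → 1 < a → inF F (a ∸ 1) b ≡ true
  upClosed = proj₂ (proj₂ (proj₂ ferrers))

  1≤n : 1 ≤ n
  1≤n = proj₂ (proj₁ (inF-inRange F topLeft))

  1≤m : 1 ≤ m
  1≤m = proj₂ (proj₂ (inF-inRange F topLeft))

  firstRow-full : ∀ b → 1 ≤ b → b ≤ m → inF F 1 b ≡ true
  firstRow-full = rightClosed-full (row 1) (rightClosed 1) topLeft

  lastColumn-full : ∀ a → 1 ≤ a → a ≤ n → inF F a m ≡ true
  lastColumn-full a 1≤a a≤n = from-bottom (n ∸ a) a 1≤a (m+[n∸m]≡n a≤n)
    where
    from-bottom : ∀ k a → 1 ≤ a → a + k ≡ n → inF F a m ≡ true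
    from-bottom zero    a _   a+0≡n = subst (λ i → inF F i m ≡ true) (trans (sym a+0≡n) (+-identityʳ a)) bottomRight
    from-bottom (suc k) a 1≤a a+1+k≡n =
      upClosed (suc a) m (from-bottom k (suc a) (s≤s z≤n) (trans (sym (+-suc a k)) a+1+k≡n)) (s≤s 1≤a)

  rowStarts : Vec ℕ n
  rowStarts = Vec.map firstTrue F

  inF≡rowStart≤ᵇ : ∀ {a b} → InRange n m a b → inF F a b ≡ (at 0 rowStarts a ≤ᵇ b)
  inF≡rowStart≤ᵇ {a} {b} ((p , q) , (r , t)) =
    trans (rightClosed-at (row a) (rightClosed a) b r t)
          (cong (_≤ᵇ b) (sym (at-map firstTrue {d′ = replicate m false} F a p q)))

  ≡diagramOf-rowStarts : F ≡ diagramOf rowStarts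
  ≡diagramOf-rowStarts = grid-ext F _ λ a b ab → trans (inF≡rowStart≤ᵇ ab) (sym (inF-diagramOf rowStarts ab))

  1≤rowStart : ∀ a → 1 ≤ a → a ≤ n → 1 ≤ at 0 rowStarts a
  1≤rowStart a p q = subst (1 ≤_) (sym (at-map firstTrue {d′ = replicate m false} F a p q)) (1≤firstTrue (row a))

  rowStart≤ : ∀ {a b} → InRange n m a b → inF F a b ≡ true → at 0 rowStarts a ≤ b
  rowStart≤ ab a,b∈F = ≤ᵇ≡true⇒≤ (trans (sym (inF≡rowStart≤ᵇ ab)) a,b∈F)

x∸1+1⊓x≡x : ∀ x → x ∸ 1 + 1 ⊓ x ≡ x
x∸1+1⊓x≡x zero    = refl
x∸1+1⊓x≡x (suc x) = +-comm x 1

module _ {n m : ℕ} (F : Grid n m) (ferrers : IsFerrers F) where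
  open FerrersDiagram F ferrers

  1≤colCount : ∀ t → 1 ≤ t → t ≤ m → 1 ≤ colCount F t
  1≤colCount t p q = subst (1 ≤_) (sym (sumTo≡∑ n _))
    (subst (_≤ ∑ n (λ a → ind (inF F a t))) (cong ind (firstRow-full t p q))
           (≤-∑ n (λ a → ind (inF F a t)) ≤-refl 1≤n))

  colCount-m : colCount F m ≡ n
  colCount-m = trans (sumTo≡∑ n _) (trans (∑-cong n (λ a p q → cong ind (lastColumn-full a p q))) (∑-const-1 n))

  module _ (2≤m : 2 ≤ m) where
    private
      m∸2+1+1≡m : m ∸ 2 + 1 + 1 ≡ m
      m∸2+1+1≡m = trans (+-assoc (m ∸ 2) 1 1) (m∸n+n≡m 2≤m)

    kappaJ₂-1+m≡size : kappaJ F 2 1 + m ≡ size F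
    kappaJ₂-1+m≡size = begin
      kappaJ F 2 1 + m
        ≡⟨ cong₂ _+_ (trans (sumTo≡∑ (m ∸ 2 + 1 + 1) _)
                            (cong (λ k → ∑ k (λ t → colCount F t ∸ 1)) m∸2+1+1≡m))
                     (sym (∑-const-1 m)) ⟩
      ∑ m (λ t → colCount F t ∸ 1) + ∑ m (λ _ → 1) ≡⟨ ∑-distrib-+ m _ _ ⟨
      ∑ m (λ t → colCount F t ∸ 1 + 1)             ≡⟨ ∑-cong m (λ t p q → m∸n+n≡m (1≤colCount t p q)) ⟩
      ∑ m (colCount F)                             ≡⟨ ∑-colCount≡size F ⟩
      size F                                       ∎

    kappaJ₂-0+n≡size : kappaJ F 2 0 + n ≡ size F
    kappaJ₂-0+n≡size = begin
      kappaJ F 2 0 + n                  ≡⟨ cong₂ _+_ (sumTo≡∑ m′ (colCount F)) (sym colCount-m) ⟩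
      ∑ m′ (colCount F) + colCount F m  ≡⟨ cong (λ t → ∑ m′ (colCount F) + colCount F t) (sym 1+m′≡m) ⟩
      ∑ (suc m′) (colCount F)           ≡⟨ cong (λ k → ∑ k (colCount F)) 1+m′≡m ⟩
      ∑ m (colCount F)                  ≡⟨ ∑-colCount≡size F ⟩
      size F                            ∎
      where
      m′ = m ∸ 2 + 1 + 0
      1+m′≡m : suc m′ ≡ m
      1+m′≡m = trans (cong suc (+-identityʳ (m ∸ 2 + 1))) (trans (+-comm 1 (m ∸ 2 + 1)) m∸2+1+1≡m)

    kappa₂+m≡size : n ≤ m → kappa F 2 + m ≡ size F
    kappa₂+m≡size n≤m = trans (cong (_+ m) (m≥n⇒m⊓n≡n kappaJ₂-1≤kappaJ₂-0)) kappaJ₂-1+m≡size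
      where
      kappaJ₂-1≤kappaJ₂-0 : kappaJ F 2 1 ≤ kappaJ F 2 0
      kappaJ₂-1≤kappaJ₂-0 = +-cancelʳ-≤ m _ _
        (≤-trans (≤-reflexive (trans kappaJ₂-1+m≡size (sym kappaJ₂-0+n≡size))) (+-monoʳ-≤ (kappaJ F 2 0) n≤m))

  -- Row 1 is full, so each of the diagonals D_1, …, D_m is nonempty.
  size≡diagBound₂+m+lowerDiagonals : size F ≡ diagBound F 2 + (m + lowerDiagonals F)
  size≡diagBound₂+m+lowerDiagonals = begin
    size F                                          ≡⟨ ∑-diagCount≡size F ⟨
    ∑ K d                                           ≡⟨ ∑-cong K (λ i _ _ → sym (x∸1+1⊓x≡x (d i))) ⟩
    ∑ K (λ i → d i ∸ 1 + 1 ⊓ d i)                   ≡⟨ ∑-distrib-+ K _ _ ⟩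
    ∑ K (λ i → d i ∸ 1) + ∑ K (λ i → 1 ⊓ d i)
      ≡⟨ cong₂ _+_ (sym (sumTo≡∑ K _)) (cong (λ k → ∑ k (λ i → 1 ⊓ d i)) (+-∸-assoc m 1≤n)) ⟩
    diagBound F 2 + ∑ (m + (n ∸ 1)) (λ i → 1 ⊓ d i) ≡⟨ cong (diagBound F 2 +_) (∑-+ m (n ∸ 1) _) ⟩
    diagBound F 2 + (∑ m (λ i → 1 ⊓ d i) + lowerDiagonals F)
      ≡⟨ cong (λ x → diagBound F 2 + (x + lowerDiagonals F)) (trans (∑-cong m nonempty) (∑-const-1 m)) ⟩
    diagBound F 2 + (m + lowerDiagonals F)          ∎
    where
    K = m + n ∸ 1
    d = diagCount F
    nonempty : ∀ i → 1 ≤ i → i ≤ m → 1 ⊓ d i ≡ 1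
    nonempty i 1≤i i≤m = m≤n⇒m⊓n≡m (1≤diagCount F {i} {1} {suc m ∸ i}
      (firstRow-full (suc m ∸ i) (m<n⇒0<n∸m (s≤s i≤m)) (∸-monoʳ-≤ (suc m) 1≤i))
      (m∸n+n≡m (m≤n⇒m≤1+n i≤m)))

  kappa₂≡diagBound₂+lowerDiagonals : 2 ≤ m → n ≤ m → kappa F 2 ≡ diagBound F 2 + lowerDiagonals F
  kappa₂≡diagBound₂+lowerDiagonals 2≤m n≤m = +-cancelʳ-≡ m _ _ (begin
    kappa F 2 + m                               ≡⟨ kappa₂+m≡size 2≤m n≤m ⟩
    size F                                      ≡⟨ size≡diagBound₂+m+lowerDiagonals ⟩
    diagBound F 2 + (m + lowerDiagonals F)      ≡⟨ cong (diagBound F 2 +_) (+-comm m (lowerDiagonals F)) ⟩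
    diagBound F 2 + (lowerDiagonals F + m)      ≡⟨ +-assoc (diagBound F 2) _ m ⟨
    diagBound F 2 + lowerDiagonals F + m        ∎)

  mds₂⇔upperTriangular : 2 ≤ m → n ≤ m → MDSConstructible F 2 ⇔ UpperTriangular F
  mds₂⇔upperTriangular 2≤m n≤m = mk⇔
    (λ mds → lowerDiagonals≡0⇒upperTriangular F
       (+-cancelˡ-≡ (diagBound F 2) _ 0 (trans (sym kappa≡) (trans mds (sym (+-identityʳ _))))))
    (λ upper → trans kappa≡ (trans (cong (diagBound F 2 +_) (upperTriangular⇒lowerDiagonals≡0 F upper)) (+-identityʳ _)))
    where kappa≡ = kappa₂≡diagBound₂+lowerDiagonals 2≤m n≤m

-- Ballot sequences

-- s_a is the column in which row a of a Ferrers diagram starts; the diagram lies on or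
-- above the main diagonal exactly when a ≤ s_a for every row a.
record IsBallot (n m : ℕ) (s : Vec ℕ n) : Set where
  field
    starts-at-1 : at 0 s 1 ≡ 1
    diagonal≤   : ∀ a → 1 ≤ a → a ≤ n → a ≤ at 0 s a
    ≤width      : ∀ a → 1 ≤ a → a ≤ n → at 0 s a ≤ m
    monotone    : ∀ a → 1 ≤ a → a < n → at 0 s a ≤ at 0 s (suc a)

module _ {n m : ℕ} {s : Vec ℕ n} (ballot : IsBallot n m s) where
  open IsBallot ballot

  monotone-≤ : ∀ {a b} → 1 ≤ a → a ≤ b → b ≤ n → at 0 s a ≤ at 0 s b
  monotone-≤ {a} {b} 1≤a a≤b b≤n with m≤n⇒m<n∨m≡n a≤b
  ... | inj₂ refl = ≤-refl
  monotone-≤ {a} {suc b} 1≤a _ b<n | inj₁ (s≤s a≤b) =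
    ≤-trans (monotone-≤ 1≤a a≤b (<⇒≤ b<n)) (monotone b (≤-trans 1≤a a≤b) b<n)

  ballot-weaken : ∀ {m′} → m ≤ m′ → IsBallot n m′ s
  ballot-weaken m≤m′ = record
    { starts-at-1 = starts-at-1
    ; diagonal≤   = diagonal≤
    ; ≤width      = λ a p q → ≤-trans (≤width a p q) m≤m′
    ; monotone    = monotone
    }

ballot-tighten : ∀ {n m} {s : Vec ℕ n} → IsBallot n (suc m) s → at 0 s n ≤ m → IsBallot n m s
ballot-tighten ballot last≤m = record
  { starts-at-1 = starts-at-1
  ; diagonal≤   = diagonal≤
  ; ≤width      = λ a p q → ≤-trans (monotone-≤ ballot p q ≤-refl) last≤m
  ; monotone    = monotone
  } where open IsBallot ballot

ballot-init : ∀ {n m x} {w : Vec ℕ (suc n)} → IsBallot (suc (suc n)) m (w ∷ʳ x) → IsBallot (suc n) m w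
ballot-init {n} {m} {x} {w} ballot = record
  { starts-at-1 = trans (sym (at-∷ʳ 0 x w 1 (s≤s z≤n))) starts-at-1
  ; diagonal≤   = λ a p q → subst (a ≤_) (at-∷ʳ 0 x w a q) (diagonal≤ a p (m≤n⇒m≤1+n q))
  ; ≤width      = λ a p q → subst (_≤ m) (at-∷ʳ 0 x w a q) (≤width a p (m≤n⇒m≤1+n q))
  ; monotone    = λ a p q → subst₂ _≤_ (at-∷ʳ 0 x w a (<⇒≤ q)) (at-∷ʳ 0 x w (suc a) q)
                                        (monotone a p (m<n⇒m<1+n q))
  } where open IsBallot ballot

ballot-∷ʳ : ∀ {n m} {w : Vec ℕ (suc n)} → suc (suc n) ≤ suc m →
            IsBallot (suc n) (suc m) w → IsBallot (suc (suc n)) (suc m) (w ∷ʳ suc m)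
ballot-∷ʳ {n} {m} {w} 2+n≤1+m ballot = record
  { starts-at-1 = trans (at-∷ʳ 0 (suc m) w 1 (s≤s z≤n)) starts-at-1
  ; diagonal≤   = diagonal≤′
  ; ≤width      = ≤width′
  ; monotone    = monotone′
  }
  where
  open IsBallot ballot
  v = w ∷ʳ suc m
  diagonal≤′ : ∀ a → 1 ≤ a → a ≤ suc (suc n) → a ≤ at 0 v a
  diagonal≤′ a p q with m≤n⇒m<n∨m≡n q
  ... | inj₁ (s≤s a≤1+n) rewrite at-∷ʳ 0 (suc m) w a a≤1+n = diagonal≤ a p a≤1+n
  ... | inj₂ refl        rewrite at-∷ʳ-last 0 (suc m) w     = 2+n≤1+m
  ≤width′ : ∀ a → 1 ≤ a → a ≤ suc (suc n) → at 0 v a ≤ suc m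
  ≤width′ a p q with m≤n⇒m<n∨m≡n q
  ... | inj₁ (s≤s a≤1+n) rewrite at-∷ʳ 0 (suc m) w a a≤1+n = ≤width a p a≤1+n
  ... | inj₂ refl        rewrite at-∷ʳ-last 0 (suc m) w     = ≤-refl
  monotone′ : ∀ a → 1 ≤ a → a < suc (suc n) → at 0 v a ≤ at 0 v (suc a)
  monotone′ a p (s≤s q) with m≤n⇒m<n∨m≡n q
  ... | inj₁ a<1+n rewrite at-∷ʳ 0 (suc m) w a q | at-∷ʳ 0 (suc m) w (suc a) a<1+n = monotone a p a<1+n
  ... | inj₂ refl  rewrite at-∷ʳ 0 (suc m) w (suc n) q | at-∷ʳ-last 0 (suc m) w   = ≤width (suc n) p ≤-refl

ballot-1≤n : ∀ {n m s} → IsBallot n m s → 1 ≤ n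
ballot-1≤n {s = []}    ballot = contradiction (IsBallot.starts-at-1 ballot) 0≢1+n
ballot-1≤n {s = _ ∷ _} _      = s≤s z≤n

ballot-1≤m : ∀ {n m s} → IsBallot n m s → 1 ≤ m
ballot-1≤m ballot = subst (_≤ _) starts-at-1 (≤width 1 ≤-refl (ballot-1≤n ballot))
  where open IsBallot ballot

module _ {n m : ℕ} {s : Vec ℕ n} (ballot : IsBallot n m s) where
  open IsBallot ballot

  diagramOf-isFerrers : IsFerrers (diagramOf {n} {m} s)
  diagramOf-isFerrers =
    ∈diagramOf⇐ s ((≤-refl , 1≤n) , (≤-refl , 1≤m)) (≤-reflexive starts-at-1) ,
    ∈diagramOf⇐ s ((1≤n , ≤-refl) , (1≤m , ≤-refl)) (≤width n 1≤n ≤-refl) ,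
    (λ a j a,j∈G j<m → let (a∈[1,n] , _) , sₐ≤j = ∈diagramOf⇒ s a,j∈G in
      ∈diagramOf⇐ s (a∈[1,n] , (s≤s z≤n , j<m)) (m≤n⇒m≤1+n sₐ≤j)) ,
    (λ { (suc a) j a,j∈G (s≤s 1≤a) → let ((_ , a<n) , j∈[1,m]) , sₐ₊₁≤j = ∈diagramOf⇒ s a,j∈G in
      ∈diagramOf⇐ s ((1≤a , <⇒≤ a<n) , j∈[1,m]) (≤-trans (monotone a 1≤a a<n) sₐ₊₁≤j) })
    where
    1≤n = ballot-1≤n ballot
    1≤m = ballot-1≤m ballot

  diagramOf-upperTriangular : UpperTriangular (diagramOf {n} {m} s)
  diagramOf-upperTriangular a b a,b∈G =
    let ((1≤a , a≤n) , _) , sₐ≤b = ∈diagramOf⇒ s a,b∈G in ≤-trans (diagonal≤ a 1≤a a≤n) sₐ≤b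

  diagramOf-≤ : ∀ {r : Vec ℕ n} → diagramOf {n} {m} r ≡ diagramOf s →
                ∀ a → 1 ≤ a → a ≤ n → at 0 r a ≤ at 0 s a
  diagramOf-≤ {r} eq a p q = proj₂ (∈diagramOf⇒ r (subst (λ G → inF G a (at 0 s a) ≡ true) (sym eq)
    (∈diagramOf⇐ s ((p , q) , (≤-trans p (diagonal≤ a p q) , ≤width a p q)) ≤-refl)))

diagramOf-injective : ∀ {n m} {r s : Vec ℕ n} → IsBallot n m r → IsBallot n m s →
                      diagramOf {n} {m} r ≡ diagramOf s → r ≡ s
diagramOf-injective br bs eq = at-ext 0 _ _ λ a p q → ≤-antisym (diagramOf-≤ bs eq a p q) (diagramOf-≤ br (sym eq) a p q)

rowStarts-isBallot : ∀ {n m} (F : Grid n m) (ferrers : IsFerrers F) →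
                     UpperTriangular F → IsBallot n m (FerrersDiagram.rowStarts F ferrers)
rowStarts-isBallot {n} {m} F ferrers upper = record
  { starts-at-1 = ≤-antisym (rowStart≤ ((≤-refl , 1≤n) , (≤-refl , 1≤m)) topLeft) (1≤rowStart 1 ≤-refl 1≤n)
  ; diagonal≤   = λ a p q → upper a _ (start∈F a p q)
  ; ≤width      = start≤m
  ; monotone    = λ a p a<n →
      rowStart≤ ((p , <⇒≤ a<n) , (1≤rowStart (suc a) (s≤s z≤n) a<n , start≤m (suc a) (s≤s z≤n) a<n))
                (upClosed (suc a) _ (start∈F (suc a) (s≤s z≤n) a<n) (s≤s p))
  }
  where
  open FerrersDiagram F ferrers
  start≤m : ∀ a → 1 ≤ a → a ≤ n → at 0 rowStarts a ≤ m
  start≤m a p q = rowStart≤ ((p , q) , (1≤m , ≤-refl)) (lastColumn-full a p q)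
  start∈F : ∀ a → 1 ≤ a → a ≤ n → inF F a (at 0 rowStarts a) ≡ true
  start∈F a p q = trans (inF≡rowStart≤ᵇ ((p , q) , (1≤rowStart a p q , start≤m a p q)))
                        (≤⇒≤ᵇ≡true (≤-refl {at 0 rowStarts a}))

-- A ballot sequence with entries at most m + 1 either has all entries at most m or ends in m + 1.
ballots : (n m : ℕ) → List (Vec ℕ n)
ballots zero          m       = []
ballots (suc zero)    zero    = []
ballots (suc zero)    (suc m) = (1 ∷ []) ∷ []
ballots (suc (suc n)) zero    = []
ballots (suc (suc n)) (suc m) =
  ballots (suc (suc n)) m ++
  (if suc (suc n) ≤ᵇ suc m then map (_∷ʳ suc m) (ballots (suc n) (suc m)) else [])

ballots-sound : ∀ n m → All (IsBallot n m) (ballots n m)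
ballots-sound zero          m       = []
ballots-sound (suc zero)    zero    = []
ballots-sound (suc zero)    (suc m) = single ∷ []
  where
  single : IsBallot 1 (suc m) (1 ∷ [])
  single = record
    { starts-at-1 = refl
    ; diagonal≤   = λ { (suc zero) _ _ → ≤-refl ; (suc (suc a)) _ (s≤s ()) }
    ; ≤width      = λ { (suc zero) _ _ → s≤s z≤n ; (suc (suc a)) _ (s≤s ()) }
    ; monotone    = λ { (suc a) _ (s≤s ()) }
    }
ballots-sound (suc (suc n)) zero    = []
ballots-sound (suc (suc n)) (suc m) = All.++⁺
  (All.map (λ b → ballot-weaken b (n≤1+n m)) (ballots-sound (suc (suc n)) m))
  (if-then-else-[] (All _) (suc (suc n) ≤ᵇ suc m) [] λ guard →
    All.map⁺ (All.map (ballot-∷ʳ (≤ᵇ≡true⇒≤ guard)) (ballots-sound (suc n) (suc m))))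

ballots-complete-step : ∀ n m →
  (∀ {s} → IsBallot (suc (suc n)) m s → s ∈ ballots (suc (suc n)) m) →
  (∀ {w} → IsBallot (suc n) (suc m) w → w ∈ ballots (suc n) (suc m)) →
  ∀ {s} → IsBallot (suc (suc n)) (suc m) s → s ∈ ballots (suc (suc n)) (suc m)
ballots-complete-step n m complete-m complete-n {s} ballot with initLast s
... | w , x , refl with m≤n⇒m<n∨m≡n (IsBallot.≤width ballot (suc (suc n)) (s≤s z≤n) ≤-refl)
...   | inj₁ (s≤s last≤m) = ∈-++⁺ˡ (complete-m (ballot-tighten ballot last≤m))
...   | inj₂ last≡1+m with trans (sym (at-∷ʳ-last 0 x w)) last≡1+m
...     | refl rewrite ≤⇒≤ᵇ≡true (subst (suc (suc n) ≤_) last≡1+m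
                                          (IsBallot.diagonal≤ ballot (suc (suc n)) (s≤s z≤n) ≤-refl)) =
  ∈-++⁺ʳ (ballots (suc (suc n)) m) (∈-map⁺ (_∷ʳ suc m) (complete-n (ballot-init ballot)))

ballots-complete : ∀ n m {s} → IsBallot n m s → s ∈ ballots n m
ballots-complete zero          m       ballot = contradiction (ballot-1≤n ballot) λ ()
ballots-complete (suc n)       zero    ballot = contradiction (ballot-1≤m ballot) λ ()
ballots-complete (suc zero)    (suc m) {x ∷ []} ballot = here (cong (_∷ []) (IsBallot.starts-at-1 ballot))
ballots-complete (suc (suc n)) (suc m) ballot =
  ballots-complete-step n m (ballots-complete (suc (suc n)) m) (ballots-complete (suc n) (suc m)) ballot

ballots-disjoint : ∀ n m → Disjoint (ballots (suc (suc n)) m) (map (_∷ʳ suc m) (ballots (suc n) (suc m)))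
ballots-disjoint n m (v∈ₗ , v∈ᵣ) with ∈-map⁻ (_∷ʳ suc m) v∈ᵣ
... | w , _ , refl = 1+n≰n (subst (_≤ m) (at-∷ʳ-last 0 (suc m) w)
        (IsBallot.≤width (All.lookup (ballots-sound (suc (suc n)) m) v∈ₗ) (suc (suc n)) (s≤s z≤n) ≤-refl))

ballots-unique : ∀ n m → Unique (ballots n m)
ballots-unique zero          m       = []
ballots-unique (suc zero)    zero    = []
ballots-unique (suc zero)    (suc m) = [] ∷ []
ballots-unique (suc (suc n)) zero    = []
ballots-unique (suc (suc n)) (suc m) = Unique.++⁺
  (ballots-unique (suc (suc n)) m)
  (if-then-else-[] Unique (suc (suc n) ≤ᵇ suc m) [] λ _ →
    Unique.map⁺ (λ {v} {w} → proj₁ ∘ ∷ʳ-injective v w) (ballots-unique (suc n) (suc m)))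
  (if-then-else-[] (Disjoint _) (suc (suc n) ≤ᵇ suc m) (λ ()) λ _ → ballots-disjoint n m)

-- Counting ballot sequences

m*[m+k]Ck≡[1+k]*[m+k]C[1+k] : ∀ m k → m * ((m + k) C k) ≡ suc k * ((m + k) C suc k)
m*[m+k]Ck≡[1+k]*[m+k]C[1+k] zero k =
  sym (trans (cong (suc k *_) (k>n⇒nCk≡0 (n<1+n k))) (*-zeroʳ (suc k)))
m*[m+k]Ck≡[1+k]*[m+k]C[1+k] (suc m) zero = begin
  suc m * 1            ≡⟨ *-identityʳ (suc m) ⟩
  suc m                ≡⟨ +-identityʳ (suc m) ⟨
  suc m + 0            ≡⟨ nC1≡n (suc m + 0) ⟨
  (suc m + 0) C 1      ≡⟨ *-identityˡ _ ⟨
  1 * ((suc m + 0) C 1) ∎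
m*[m+k]Ck≡[1+k]*[m+k]C[1+k] (suc m) (suc k) = begin
  suc m * (suc N C suc k)                ≡⟨ cong (suc m *_) (nCk+nC[k+1]≡[n+1]C[k+1] N k) ⟨
  suc m * (N C k + N C suc k)            ≡⟨ *-distribˡ-+ (suc m) (N C k) (N C suc k) ⟩
  suc m * (N C k) + (N C suc k + m * (N C suc k))
    ≡⟨ cong₂ (λ x y → x + (N C suc k + y)) shifted (m*[m+k]Ck≡[1+k]*[m+k]C[1+k] m (suc k)) ⟩
  suc k * (N C suc k) + (N C suc k + suc (suc k) * (N C suc (suc k)))
    ≡⟨ solve 3 (λ k x y → (con 1 :+ k) :* x :+ (x :+ (con 2 :+ k) :* y) := (con 2 :+ k) :* (x :+ y))
             refl k (N C suc k) (N C suc (suc k)) ⟩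
  suc (suc k) * (N C suc k + N C suc (suc k)) ≡⟨ cong (suc (suc k) *_) (nCk+nC[k+1]≡[n+1]C[k+1] N (suc k)) ⟩
  suc (suc k) * (suc N C suc (suc k))    ∎
  where
  N = m + suc k
  shifted : suc m * (N C k) ≡ suc k * (N C suc k)
  shifted = subst (λ z → suc m * (z C k) ≡ suc k * (z C suc k)) (sym (+-suc m k))
                  (m*[m+k]Ck≡[1+k]*[m+k]C[1+k] (suc m) k)

ballots-empty : ∀ n m → m < n → ballots n m ≡ []
ballots-empty (suc zero)    zero    _ = refl
ballots-empty (suc zero)    (suc m) (s≤s ())
ballots-empty (suc (suc n)) zero    _ = refl
ballots-empty (suc (suc n)) (suc m) 1+m<2+n rewrite >⇒≤ᵇ≡false 1+m<2+n =
  trans (++-identityʳ (ballots (suc (suc n)) m)) (ballots-empty (suc (suc n)) m (<-trans (n<1+n m) 1+m<2+n))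

length-ballots-2 : ∀ m → length (ballots 2 (suc m)) ≡ m
length-ballots-2 zero    = refl
length-ballots-2 (suc m) =
  trans (length-++ (ballots 2 (suc m))) (trans (cong (_+ 1) (length-ballots-2 m)) (+-comm m 1))

length-ballots-split : ∀ n m → suc (suc n) ≤ suc m →
  length (ballots (suc (suc n)) (suc m)) ≡ length (ballots (suc (suc n)) m) + length (ballots (suc n) (suc m))
length-ballots-split n m 2+n≤1+m rewrite ≤⇒≤ᵇ≡true 2+n≤1+m =
  trans (length-++ (ballots (suc (suc n)) m))
        (cong (length (ballots (suc (suc n)) m) +_) (length-map (_∷ʳ suc m) (ballots (suc n) (suc m))))

-- The reflection principle |ballots (k + 2) m| = C(m + k, k + 1) − C(m + k, k), stated without subtraction.
BallotReflection : ℕ → ℕ → Set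
BallotReflection k m = length (ballots (suc (suc k)) m) + (m + k) C k ≡ (m + k) C suc k

ballotReflection-diagonal : ∀ k → BallotReflection k (suc k)
ballotReflection-diagonal k = begin
  length (ballots (suc (suc k)) (suc k)) + N C k
    ≡⟨ cong (λ xs → length xs + N C k) (ballots-empty (suc (suc k)) (suc k) ≤-refl) ⟩
  N C k                                          ≡⟨ nCk≡nC[n∸k] (m≤n+m k (suc k)) ⟩
  N C (N ∸ k)                                    ≡⟨ cong (N C_) (m+n∸n≡m (suc k) k) ⟩
  N C suc k                                      ∎
  where N = suc k + k

ballotReflection-step : ∀ k m → k < m →
  (suc k < m → BallotReflection (suc k) m) → BallotReflection k (suc m) → BallotReflection (suc k) (suc m)
ballotReflection-step k m k<m reflection-m reflection-k with m≤n⇒m<n∨m≡n k<m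
... | inj₂ refl = ballotReflection-diagonal (suc k)
... | inj₁ 1+k<m = begin
  length (ballots (suc (suc (suc k))) (suc m)) + suc N C suc k
    ≡⟨ cong₂ _+_ (length-ballots-split (suc k) m (s≤s 1+k<m)) (sym (nCk+nC[k+1]≡[n+1]C[k+1] N k)) ⟩
  (A + B) + (N C k + N C suc k)        ≡⟨ cong ((A + B) +_) (+-comm (N C k) (N C suc k)) ⟩
  (A + B) + (N C suc k + N C k)        ≡⟨ interchange +-commutativeSemigroup A B (N C suc k) (N C k) ⟩
  (A + N C suc k) + (B + N C k)        ≡⟨ cong₂ _+_ (reflection-m 1+k<m) shifted ⟩
  N C suc (suc k) + N C suc k          ≡⟨ +-comm (N C suc (suc k)) (N C suc k) ⟩
  N C suc k + N C suc (suc k)          ≡⟨ nCk+nC[k+1]≡[n+1]C[k+1] N (suc k) ⟩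
  suc N C suc (suc k)                  ∎
  where
  N = m + suc k
  A = length (ballots (suc (suc (suc k))) m)
  B = length (ballots (suc (suc k)) (suc m))
  shifted : B + N C k ≡ N C suc k
  shifted = subst (λ z → B + z C k ≡ z C suc k) (sym (+-suc m k)) reflection-k

ballotReflection : ∀ k m → k < m → BallotReflection k m
ballotReflection zero (suc m) _ = begin
  length (ballots 2 (suc m)) + 1 ≡⟨ cong (_+ 1) (length-ballots-2 m) ⟩
  m + 1                          ≡⟨ +-comm m 1 ⟩
  suc m                          ≡⟨ +-identityʳ (suc m) ⟨
  suc m + 0                      ≡⟨ nC1≡n (suc m + 0) ⟨
  (suc m + 0) C 1                ∎
ballotReflection (suc k) (suc m) (s≤s k<m) =
  ballotReflection-step k m k<m (ballotReflection (suc k) m) (ballotReflection k (suc m) (m<n⇒m<1+n k<m))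

m*|ballots|≡ : ∀ {n m} → 2 ≤ n → n ≤ m → m * length (ballots n m) ≡ (m ∸ n + 1) * ((m + n ∸ 2) C (n ∸ 1))
m*|ballots|≡ {suc (suc k)} {m} (s≤s (s≤s z≤n)) n≤m = begin
  m * A             ≡⟨ +-cancelʳ-≡ (suc k * B₁) (m * A) (q * B₁) multiplied ⟩
  q * B₁            ≡⟨ cong (λ z → q * (z C suc k)) m+k≡m+n∸2 ⟩
  q * ((m + suc (suc k) ∸ 2) C suc k) ∎
  where
  A  = length (ballots (suc (suc k)) m)
  B₀ = (m + k) C k
  B₁ = (m + k) C suc k
  q  = m ∸ suc (suc k) + 1
  m+k≡m+n∸2 : m + k ≡ m + suc (suc k) ∸ 2
  m+k≡m+n∸2 = cong (_∸ 2) (sym (trans (+-suc m (suc k)) (cong suc (+-suc m k))))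
  multiplied : m * A + suc k * B₁ ≡ q * B₁ + suc k * B₁
  multiplied = begin
    m * A + suc k * B₁   ≡⟨ cong (m * A +_) (m*[m+k]Ck≡[1+k]*[m+k]C[1+k] m k) ⟨
    m * A + m * B₀       ≡⟨ *-distribˡ-+ m A B₀ ⟨
    m * (A + B₀)         ≡⟨ cong (m *_) (ballotReflection k m (≤-trans (n≤1+n (suc k)) n≤m)) ⟩
    m * B₁               ≡⟨ cong (_* B₁) (trans (+-assoc (m ∸ suc (suc k)) 1 (suc k)) (m∸n+n≡m n≤m)) ⟨
    (q + suc k) * B₁     ≡⟨ *-distribʳ-+ B₁ q (suc k) ⟩
    q * B₁ + suc k * B₁  ∎

n*|ballots[n,n]|≡ : ∀ {n} → 2 ≤ n → n * length (ballots n n) ≡ (2 * n ∸ 2) C (n ∸ 1)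
n*|ballots[n,n]|≡ {n} 2≤n = begin
  n * length (ballots n n)               ≡⟨ m*|ballots|≡ 2≤n ≤-refl ⟩
  (n ∸ n + 1) * ((n + n ∸ 2) C (n ∸ 1))  ≡⟨ cong (λ k → (k + 1) * ((n + n ∸ 2) C (n ∸ 1))) (n∸n≡0 n) ⟩
  1 * ((n + n ∸ 2) C (n ∸ 1))            ≡⟨ *-identityˡ _ ⟩
  (n + n ∸ 2) C (n ∸ 1)                  ≡⟨ cong (λ k → (n + k ∸ 2) C (n ∸ 1)) (+-identityʳ n) ⟨
  (2 * n ∸ 2) C (n ∸ 1)                  ∎

ballotDiagrams : (n m : ℕ) → List (Grid n m)
ballotDiagrams n m = map diagramOf (ballots n m)

ballotDiagrams-unique : ∀ n m → Unique (ballotDiagrams n m)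
ballotDiagrams-unique n m =
  Unique-map⁺ diagramOf (λ r∈ s∈ → diagramOf-injective (ballot r∈) (ballot s∈)) (ballots-unique n m)
  where ballot = All.lookup (ballots-sound n m)

∈-ballotDiagrams⇔ : ∀ {n m} → 2 ≤ m → n ≤ m →
                    ∀ F → F ∈ ballotDiagrams n m ⇔ (IsFerrers F × MDSConstructible F 2)
∈-ballotDiagrams⇔ {n} {m} 2≤m n≤m F = mk⇔ to from
  where
  to : F ∈ ballotDiagrams n m → IsFerrers F × MDSConstructible F 2
  to F∈ with ∈-map⁻ diagramOf F∈
  ... | s , s∈ , refl = diagramOf-isFerrers ballot ,
                        Equivalence.from (mds₂⇔upperTriangular F (diagramOf-isFerrers ballot) 2≤m n≤m)
                                         (diagramOf-upperTriangular ballot)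
    where ballot = All.lookup (ballots-sound n m) s∈
  from : IsFerrers F × MDSConstructible F 2 → F ∈ ballotDiagrams n m
  from (ferrers , mds) = subst (_∈ ballotDiagrams n m) (sym ≡diagramOf-rowStarts) (∈-map⁺ diagramOf
    (ballots-complete n m (rowStarts-isBallot F ferrers
      (Equivalence.to (mds₂⇔upperTriangular F ferrers 2≤m n≤m) mds))))
    where open FerrersDiagram F ferrers

theorem5p7 : (m n : ℕ) → 2 ≤ n → n ≤ m →
    Σ (List (Grid n m)) (λ L →
      Unique L ×
      (∀ F → (F ∈ L) ⇔ (IsFerrers F × MDSConstructible F 2)) ×
      (m * length L ≡ (m ∸ n + 1) * ((m + n ∸ 2) C (n ∸ 1))) ×
      (m ≡ n → n * length L ≡ (2 * n ∸ 2) C (n ∸ 1)))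
theorem5p7 m n 2≤n n≤m =
  ballotDiagrams n m ,
  ballotDiagrams-unique n m ,
  ∈-ballotDiagrams⇔ (≤-trans 2≤n n≤m) n≤m ,
  trans (cong (m *_) (length-map diagramOf (ballots n m))) (m*|ballots|≡ 2≤n n≤m) ,
  λ { refl → trans (cong (n *_) (length-map diagramOf (ballots n n))) (n*|ballots[n,n]|≡ 2≤n) }
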